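{- Let $\Delta$ be a nonpure strongly shellable simplicial complex and let $\succ$ be a strong shelling order on $\mathcal{F}(\Delta)$. Then every linear order $\succ'$ on $\mathcal{F}(\Delta)$ with $\operatorname{Inv}_{\succ}(\succ') \subseteq \operatorname{Inv}(\succ)$ is also a strong shelling order on $\mathcal{F}(\Delta)$.
   Context: A simplicial complex $\Delta$ is a finite family of subsets of a vertex set closed under taking subsets; $\mathcal{F}(\Delta)$ is its set of facets (maximal faces), $\dim(A)=|A|-1$. $\Delta$ is nonpure if its facets do not all have the same dimension. A linear order on $\mathcal{F}(\Delta)$ is written $F_1,\dots,F_t$, meaning $F_i\succ F_j$ iff $i<j$. Such an order is a strong shelling order if for every $1\le i<j\le t$ there exists $k$ with $1\le k<j$ such that $|F_j\setminus F_k|=1$, $F_j\setminus F_k\subseteq F_j\setminus F_i$, and $F_k\setminus F_j\subseteq F_i$; $\Delta$ is strongly shellable if such an order exists. Given a linear order $\succ$ on $\mathcal{F}(\Delta)$, the induced dimension-related order $\vdash_\succ$ is defined by $F\vdash_\succ G$ iff either $\dim F>\dim G$, or $\dim F=\dim G$ and $F\succ G$. For another linear order $\succ'$ on $\mathcal{F}(\Delta)$, an ordered pair $(F,G)$ of facets is a relative inverse pair with respect to $\succ$ if $F\vdash_\succ G$ and $G\succ' F$; $\operatorname{Inv}_\succ(\succ')$ denotes the set of these pairs, and $\operatorname{Inv}(\succ):=\operatorname{Inv}_\succ(\succ)$, i.e. with $\succ: F_1,\dots,F_t$, $(F_i,F_j)\in\operatorname{Inv}(\succ)$ iff $j<i$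 and $\dim F_j<\dim F_i$. -}

module Defs where

open import Data.Nat using (ℕ; _<_; _>_)
open import Data.Fin using (Fin)
open import Data.Fin.Subset using (Subset; _⊆_; _─_; ∣_∣)
open import Data.Product using (Σ; _×_; ∃)
open import Data.Sum using (_⊎_)
open import Relation.Binary.PropositionalEquality using (_≡_; _≢_)
open import Relation.Nullary using (¬_)
open import Function.Bundles using (Inverse; _↔_)

-- A simplicial complex on the vertex set Fin n, presented by its list of
-- facets F : Fin t → Subset n (Δ = all subsets of some F i).
record FacetFamily (n t : ℕ) : Set where
  field
    facet    : Fin t → Subset n
    antichain : ∀ i j → i ≢ j → ¬ (facet i ⊆ facet j)
open FacetFamily public

-- dim A = |A| - 1, so comparisons of dimensions are comparisons of sizes.
-- Nonpure: two facets of different dimension.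
Nonpure : ∀ {n t} → FacetFamily n t → Set
Nonpure Δ = Σ (Fin _) λ i → Σ (Fin _) λ j → ∣ facet Δ i ∣ ≢ ∣ facet Δ j ∣

-- A linear order on the facets F(Δ) (indexed by Fin t): a bijection
-- between positions and facet indices; position p holds facet (to p),
-- i.e. the order lists F_{to 0}, F_{to 1}, ..., F_{to (t-1)}.
LinOrder : ℕ → Set
LinOrder t = Fin t ↔ Fin t

position : ∀ {t} → LinOrder t → Fin t → ℕ
position σ a = Data.Fin.toℕ (Inverse.from σ a)

_≻⟨_⟩_ : ∀ {t} → Fin t → LinOrder t → Fin t → Set
a ≻⟨ σ ⟩ b = position σ a < position σ b

StrongShellingOrder : ∀ {n t} → FacetFamily n t → LinOrder t → Set
StrongShellingOrder {n} {t} Δ σ =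
  ∀ (i j : Fin t) → i ≻⟨ σ ⟩ j →
    Σ (Fin t) λ k → k ≻⟨ σ ⟩ j
      × ∣ facet Δ j ─ facet Δ k ∣ ≡ 1
      × (facet Δ j ─ facet Δ k) ⊆ (facet Δ j ─ facet Δ i)
      × (facet Δ k ─ facet Δ j) ⊆ facet Δ i

StronglyShellable : ∀ {n t} → FacetFamily n t → Set
StronglyShellable {t = t} Δ = Σ (LinOrder t) λ σ → StrongShellingOrder Δ σ

_⊢⟨_,_⟩_ : ∀ {n t} → Fin t → FacetFamily n t → LinOrder t → Fin t → Set
a ⊢⟨ Δ , σ ⟩ b = (∣ facet Δ a ∣ > ∣ facet Δ b ∣)
               ⊎ (∣ facet Δ a ∣ ≡ ∣ facet Δ b ∣ × a ≻⟨ σ ⟩ b)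

RelInv : ∀ {n t} → FacetFamily n t → LinOrder t → LinOrder t → Fin t → Fin t → Set
RelInv Δ σ τ a b = a ⊢⟨ Δ , σ ⟩ b × b ≻⟨ τ ⟩ a

Inv : ∀ {n t} → FacetFamily n t → LinOrder t → Fin t → Fin t → Set
Inv Δ σ = RelInv Δ σ σ

-- Let i ≻_τ j.  If also i ≻_σ j, the σ-witness k for (i, j) serves: it has
-- |F_j ∖ F_k| = 1 and F_k ⊈ F_j, so dim F_k ≥ dim F_j, and a pair ordered by σ
-- with the earlier facet not smaller cannot be inverted by τ, so k ≻_τ j.
-- If instead j ≻_σ i, the σ-witness k₁ for (j, i) is not smaller than F_i, so
-- k₁ ≻_τ i ≻_τ j, and F_j ∖ F_{k₁} ⊊ F_j ∖ F_i.  By induction on |F_j ∖ F_i| the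
-- pair (k₁, j) has a τ-witness k, and k is also a witness for (i, j).
module Submission where

open import Defs
open import Data.Nat using (ℕ; suc; _+_; _≤_; _<_; s≤s; z≤n)
open import Data.Nat.Properties
  using (+-suc; +-cancelʳ-≤; +-monoʳ-≤; ≤-trans; <-irrefl; <-asym; <-trans; <-cmp; m≤n⇒m<n∨m≡n)
open import Data.Nat.Induction using (<-wellFounded)
open import Data.Fin using (Fin; toℕ)
open import Data.Fin.Properties using (toℕ-injective; ¬∀⟶∃¬)
open import Data.Fin.Subset using (Subset; _⊆_; _─_; ∣_∣; _∈_; _∉_; Nonempty; inside; outside)
open import Data.Fin.Subset.Properties using (_∈?_; ∣p∣≤∣x∷p∣; p─q⊆p; x∈p∧x∉q⇒x∈p─q; p⊂q⇒∣p∣<∣q∣)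
open import Data.Vec using ([]; _∷_)
open import Data.Vec.Base using (here; there)
open import Data.Product using (Σ; _×_; ∃; _,_)
open import Data.Sum using (_⊎_; inj₁; inj₂)
open import Function.Bundles using (Inverse)
open import Induction.WellFounded using (WellFounded; Acc; acc)
open import Relation.Binary using (tri<; tri≈; tri>)
import Relation.Binary.Construct.On as On
open import Relation.Binary.PropositionalEquality using (_≡_; _≢_; refl; sym; trans; cong; subst)
open import Relation.Nullary using (¬_; yes; no; contradiction)
open import Relation.Nullary.Decidable using (_→-dec_)

∣p∣+∣q─p∣≡∣q∣+∣p─q∣ : ∀ {n} (p q : Subset n) → ∣ p ∣ + ∣ q ─ p ∣ ≡ ∣ q ∣ + ∣ p ─ q ∣
∣p∣+∣q─p∣≡∣q∣+∣p─q∣ []            []            = refl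
∣p∣+∣q─p∣≡∣q∣+∣p─q∣ (inside  ∷ p) (inside  ∷ q) = cong suc (∣p∣+∣q─p∣≡∣q∣+∣p─q∣ p q)
∣p∣+∣q─p∣≡∣q∣+∣p─q∣ (inside  ∷ p) (outside ∷ q) =
  trans (cong suc (∣p∣+∣q─p∣≡∣q∣+∣p─q∣ p q)) (sym (+-suc ∣ q ∣ _))
∣p∣+∣q─p∣≡∣q∣+∣p─q∣ (outside ∷ p) (inside  ∷ q) =
  trans (+-suc ∣ p ∣ _) (cong suc (∣p∣+∣q─p∣≡∣q∣+∣p─q∣ p q))
∣p∣+∣q─p∣≡∣q∣+∣p─q∣ (outside ∷ p) (outside ∷ q) = ∣p∣+∣q─p∣≡∣q∣+∣p─q∣ p q

Nonempty⇒1≤∣p∣ : ∀ {n} (p : Subset n) → Nonempty p → 1 ≤ ∣ p ∣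
Nonempty⇒1≤∣p∣ (inside ∷ p) (_ , here)    = s≤s z≤n
Nonempty⇒1≤∣p∣ (s ∷ p)      (_ , there x) = ≤-trans (Nonempty⇒1≤∣p∣ p (_ , x)) (∣p∣≤∣x∷p∣ s p)

x∈p─q⇒x∉q : ∀ {n} (p q : Subset n) {x : Fin n} → x ∈ p ─ q → x ∉ q
x∈p─q⇒x∉q (_ ∷ p) (_ ∷ q) (there x∈p─q) (there x∈q) = x∈p─q⇒x∉q p q x∈p─q x∈q

p⊈q⇒∃∈∧∉ : ∀ {n} (p q : Subset n) → ¬ p ⊆ q → ∃ λ x → x ∈ p × x ∉ q
p⊈q⇒∃∈∧∉ {n} p q p⊈q
  with ¬∀⟶∃¬ n (λ x → x ∈ p → x ∈ q) (λ x → x ∈? p →-dec x ∈? q) (λ p⊆q → p⊈q (p⊆q _))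
... | x , x∈p⇏x∈q with x ∈? p
...   | yes x∈p = x , x∈p , (λ x∈q → x∈p⇏x∈q (λ _ → x∈q))
...   | no  x∉p = contradiction (λ x∈p → contradiction x∈p x∉p) x∈p⇏x∈q

∣q─p∣≡1⇒p⊈q⇒∣q∣≤∣p∣ : ∀ {n} (p q : Subset n) → ∣ q ─ p ∣ ≡ 1 → ¬ p ⊆ q → ∣ q ∣ ≤ ∣ p ∣
∣q─p∣≡1⇒p⊈q⇒∣q∣≤∣p∣ p q ∣q─p∣≡1 p⊈q with p⊈q⇒∃∈∧∉ p q p⊈q
... | x , x∈p , x∉q = +-cancelʳ-≤ 1 ∣ q ∣ ∣ p ∣
  (subst (λ d → ∣ q ∣ + 1 ≤ ∣ p ∣ + d) ∣q─p∣≡1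
    (subst (∣ q ∣ + 1 ≤_) (sym (∣p∣+∣q─p∣≡∣q∣+∣p─q∣ p q))
      (+-monoʳ-≤ ∣ q ∣ (Nonempty⇒1≤∣p∣ (p ─ q) (x , x∈p∧x∉q⇒x∈p─q x∈p x∉q)))))

p─r⊆p─q⇒q─r⊆q─p : ∀ {n} (p q r : Subset n) → (p ─ r) ⊆ (p ─ q) → (q ─ r) ⊆ (q ─ p)
p─r⊆p─q⇒q─r⊆q─p p q r p─r⊆p─q {x} x∈q─r = x∈p∧x∉q⇒x∈p─q x∈q x∉p
  where
  x∈q = p─q⊆p q r x∈q─r
  x∉p = λ x∈p → x∈p─q⇒x∉q p q (p─r⊆p─q (x∈p∧x∉q⇒x∈p─q x∈p (x∈p─q⇒x∉q q r x∈q─r))) x∈q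

ShellingWitness : ∀ {n} → Subset n → Subset n → Subset n → Set
ShellingWitness A B C = ∣ B ─ C ∣ ≡ 1 × (B ─ C) ⊆ (B ─ A) × (C ─ B) ⊆ A

witness-closer : ∀ {n} {A B K : Subset n} → ShellingWitness B A K → ¬ K ⊆ A →
                 ∣ B ─ K ∣ < ∣ B ─ A ∣
witness-closer {A = A} {B} {K} (_ , A─K⊆A─B , K─A⊆B) K⊈A with p⊈q⇒∃∈∧∉ K A K⊈A
... | x , x∈K , x∉A = p⊂q⇒∣p∣<∣q∣
  ( p─r⊆p─q⇒q─r⊆q─p A B K A─K⊆A─B
  , x , x∈p∧x∉q⇒x∈p─q (K─A⊆B (x∈p∧x∉q⇒x∈p─q x∈K x∉A)) x∉A
  , (λ x∈B─K → x∈p─q⇒x∉q B K x∈B─K x∈K) )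

witness-transfer : ∀ {n} {A B K C : Subset n} → ShellingWitness B A K →
                   ShellingWitness K B C → ShellingWitness A B C
witness-transfer {A = A} {B} {K} {C} (_ , A─K⊆A─B , K─A⊆B) (∣B─C∣≡1 , B─C⊆B─K , C─B⊆K) =
  ∣B─C∣≡1 , (λ x∈B─C → p─r⊆p─q⇒q─r⊆q─p A B K A─K⊆A─B (B─C⊆B─K x∈B─C)) , C─B⊆A
  where
  C─B⊆A : (C ─ B) ⊆ A
  C─B⊆A {x} x∈C─B with x ∈? A
  ... | yes x∈A = x∈A
  ... | no  x∉A = contradiction (K─A⊆B (x∈p∧x∉q⇒x∈p─q (C─B⊆K x∈C─B) x∉A)) (x∈p─q⇒x∉q C B x∈C─B)

position-injective : ∀ {t} (ρ : LinOrder t) {a b : Fin t} → position ρ a ≡ position ρ b → a ≡ b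
position-injective ρ {a} {b} eq = trans (sym (Inverse.strictlyInverseˡ ρ a))
  (trans (cong (Inverse.to ρ) (toℕ-injective eq)) (Inverse.strictlyInverseˡ ρ b))

≻⇒≢ : ∀ {t} (ρ : LinOrder t) {a b : Fin t} → a ≻⟨ ρ ⟩ b → a ≢ b
≻⇒≢ ρ a≻a refl = <-irrefl refl a≻a

≢⇒≻⊎≺ : ∀ {t} (ρ : LinOrder t) {a b : Fin t} → a ≢ b → a ≻⟨ ρ ⟩ b ⊎ b ≻⟨ ρ ⟩ a
≢⇒≻⊎≺ ρ {a} {b} a≢b with <-cmp (position ρ a) (position ρ b)
... | tri< a≻b _ _ = inj₁ a≻b
... | tri≈ _ eq _  = contradiction (position-injective ρ eq) a≢b
... | tri> _ _ b≻a = inj₂ b≻a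

module _ {n t : ℕ} (Δ : FacetFamily n t) where

  private
    F : Fin t → Subset n
    F = facet Δ

  _closerTo_than_ : Fin t → Fin t → Fin t → Set
  k closerTo j than i = ∣ F j ─ F k ∣ < ∣ F j ─ F i ∣

  closerTo-wellFounded : ∀ j → WellFounded (_closerTo j than_)
  closerTo-wellFounded j = On.wellFounded (λ i → ∣ F j ─ F i ∣) <-wellFounded

  module _ (σ : LinOrder t) (σ-shelling : StrongShellingOrder Δ σ)
           (τ : LinOrder t) (Inv-⊆ : ∀ (a b : Fin t) → RelInv Δ σ τ a b → Inv Δ σ a b) where

    ≻σ∧∣Fb∣≤∣Fa∣⇒≻τ : ∀ {a b} → a ≻⟨ σ ⟩ b → ∣ F b ∣ ≤ ∣ F a ∣ → a ≻⟨ τ ⟩ b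
    ≻σ∧∣Fb∣≤∣Fa∣⇒≻τ {a} {b} a≻σb ∣Fb∣≤∣Fa∣ with ≢⇒≻⊎≺ τ (≻⇒≢ σ a≻σb)
    ... | inj₁ a≻τb = a≻τb
    ... | inj₂ b≻τa with Inv-⊆ a b (a⊢b , b≻τa)
      where
      a⊢b : a ⊢⟨ Δ , σ ⟩ b
      a⊢b with m≤n⇒m<n∨m≡n ∣Fb∣≤∣Fa∣
      ... | inj₁ ∣Fb∣<∣Fa∣ = inj₁ ∣Fb∣<∣Fa∣
      ... | inj₂ ∣Fb∣≡∣Fa∣ = inj₂ (sym ∣Fb∣≡∣Fa∣ , a≻σb)
    ...   | _ , b≻σa = contradiction b≻σa (<-asym a≻σb)

    σ-witness-≻τ : ∀ {i j k} → k ≻⟨ σ ⟩ j → ShellingWitness (F i) (F j) (F k) → k ≻⟨ τ ⟩ j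
    σ-witness-≻τ {j = j} {k} k≻σj (∣Fj─Fk∣≡1 , _) = ≻σ∧∣Fb∣≤∣Fa∣⇒≻τ k≻σj
      (∣q─p∣≡1⇒p⊈q⇒∣q∣≤∣p∣ (F k) (F j) ∣Fj─Fk∣≡1 (antichain Δ k j (≻⇒≢ σ k≻σj)))

    τ-witness : ∀ {i j} → Acc (_closerTo j than_) i → i ≻⟨ τ ⟩ j →
                Σ (Fin t) λ k → k ≻⟨ τ ⟩ j × ShellingWitness (F i) (F j) (F k)
    τ-witness {i} {j} (acc closer) i≻τj with ≢⇒≻⊎≺ σ (≻⇒≢ τ i≻τj)
    ... | inj₁ i≻σj with σ-shelling i j i≻σj
    ...   | k , k≻σj , w = k , σ-witness-≻τ k≻σj w , w
    τ-witness {i} {j} (acc closer) i≻τj | inj₂ j≻σi with σ-shelling j i j≻σi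
    ... | k₁ , k₁≻σi , w₁ with τ-witness (closer k₁-closer) (<-trans (σ-witness-≻τ k₁≻σi w₁) i≻τj)
      where
      k₁-closer : k₁ closerTo j than i
      k₁-closer = witness-closer w₁ (antichain Δ k₁ i (≻⇒≢ σ k₁≻σi))
    ...   | k , k≻τj , w = k , k≻τj , witness-transfer w₁ w

theorem2p8 : ∀ {n t : ℕ} (Δ : FacetFamily n t) → Nonpure Δ → StronglyShellable Δ →
    (σ : LinOrder t) → StrongShellingOrder Δ σ →
    (τ : LinOrder t) → (∀ (a b : Fin t) → RelInv Δ σ τ a b → Inv Δ σ a b) →
    StrongShellingOrder Δ τ
theorem2p8 Δ _ _ σ σ-shelling τ Inv-⊆ i j =
  τ-witness Δ σ σ-shelling τ Inv-⊆ (closerTo-wellFounded Δ j i)
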